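{- Let $n$ be a positive integer and let $g_2(n+1)$ denote the total number of gap vectors (equivalently, the total number of steps) summed over all simple jump paths in dimension $2$ from $(n+1,n+1)$ to $(0,0)$. Then \[ g_2(n+1) \;=\; \left(\frac{n}{2}+1\right)\binom{2n}{n}.\]
   Context: A simple jump path in dimension $2$ of length $k$ starting at $(a_1,a_2)$ is a sequence of lattice points $(x_{0,1},x_{0,2}),\dots,(x_{k,1},x_{k,2})$ in $\mathbb{Z}_{\ge 0}^2$ with $(x_{0,1},x_{0,2})=(a_1,a_2)$, $(x_{k,1},x_{k,2})=(0,0)$, and $x_{i,j}>x_{i+1,j}$ for all $i\in\{0,\dots,k-1\}$ and $j\in\{1,2\}$. A path of length $k$ has $k$ steps and hence $k$ gap vectors, where the gap vector of a step from $(x_{i,1},x_{i,2})$ to $(x_{i+1,1},x_{i+1,2})$ is $(x_{i,1}-x_{i+1,1},\,x_{i,2}-x_{i+1,2})$. -}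

module Defs where

open import Data.Nat using (ℕ; zero; suc; _+_; _<_)
open import Data.List using (List; map)
open import Data.Nat.ListAction using (sum)

data JumpPath : ℕ → ℕ → Set where
  stop : JumpPath 0 0
  step : ∀ {a₁ a₂} (b₁ b₂ : ℕ) → b₁ < a₁ → b₂ < a₂ → JumpPath b₁ b₂ → JumpPath a₁ a₂

len : ∀ {a₁ a₂} → JumpPath a₁ a₂ → ℕ
len stop = 0
len (step _ _ _ _ p) = suc (len p)

totalGaps : ∀ {a₁ a₂} → List (JumpPath a₁ a₂) → ℕ
totalGaps ps = sum (map len ps)

{-# OPTIONS --safe #-}
-- A jump path of length k from (a , b) is a pair of strictly decreasing chains of length k, from a and
-- from b down to 0, and there are (a − 1) C (k − 1) such chains from a. So the paths from (n + 1 , n + 1)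
-- have Σⱼ (j + 1) (n C j)² steps in total. Pairing j with n − j, which has the same weight (n C j)²,
-- replaces the factor j + 1 by (n + 2) / 2, and Σⱼ (n C j)² = 2n C n by Vandermonde's identity.
module Submission where

open import Defs
open import Data.Nat using (ℕ; zero; suc; _*_; _+_; _∸_; _≤_; _<_; s≤s; z≤n; z<s)
open import Data.Nat.Properties
open import Data.Nat.Combinatorics using (_C_; nCk+nC[k+1]≡[n+1]C[k+1]; nCk≡nC[n∸k]; k>n⇒nCk≡0)
open import Data.Nat.ListAction using (sum)
open import Data.Nat.ListAction.Properties using (sum-++)
open import Data.Product using (Σ; _×_; _,_; proj₁; proj₂)
open import Data.List using (List; []; _∷_; _++_; map; concatMap; length; downFrom)
open import Data.List.Properties using (length-++; map-++; map-∘; map-cong; length-map)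
open import Data.List.Membership.Propositional using (_∈_; lose)
open import Data.List.Membership.Propositional.Properties using (∈-map⁺; ∈-concatMap⁺)
open import Data.List.Relation.Unary.Any using (here; there)
open import Data.List.Relation.Unary.All as All using (All; []; _∷_)
import Data.List.Relation.Unary.All.Properties as All
open import Data.List.Relation.Unary.AllPairs as AllPairs using ([]; _∷_)
import Data.List.Relation.Unary.AllPairs.Properties as AllPairs
open import Data.List.Relation.Binary.Disjoint.Propositional using (Disjoint)
open import Data.List.Relation.Unary.Unique.Propositional using (Unique)
import Data.List.Relation.Unary.Unique.Propositional.Properties as Unique
open import Relation.Binary.PropositionalEquality
open import Function using (_∘_)
open import Relation.Nullary using (yes; no)
open import Algebra.Properties.CommutativeSemigroup +-commutativeSemigroup using (interchange; x∙yz≈y∙xz)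

∑< : ℕ → (ℕ → ℕ) → ℕ
∑< n f = sum (map f (downFrom n))

∑<-cong : ∀ n {f g : ℕ → ℕ} → (∀ i → i < n → f i ≡ g i) → ∑< n f ≡ ∑< n g
∑<-cong zero    f≗g = refl
∑<-cong (suc n) f≗g = cong₂ _+_ (f≗g n ≤-refl) (∑<-cong n (λ i i<n → f≗g i (m<n⇒m<1+n i<n)))

∑<-+ : ∀ n (f g : ℕ → ℕ) → ∑< n (λ i → f i + g i) ≡ ∑< n f + ∑< n g
∑<-+ zero    f g = refl
∑<-+ (suc n) f g = trans (cong ((f n + g n) +_) (∑<-+ n f g)) (interchange (f n) (g n) (∑< n f) (∑< n g))

∑<-*ˡ : ∀ n c (f : ℕ → ℕ) → ∑< n (λ i → c * f i) ≡ c * ∑< n f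
∑<-*ˡ zero    c f = sym (*-zeroʳ c)
∑<-*ˡ (suc n) c f = trans (cong (c * f n +_) (∑<-*ˡ n c f)) (sym (*-distribˡ-+ c (f n) _))

∑<-*ʳ : ∀ n c (f : ℕ → ℕ) → ∑< n (λ i → f i * c) ≡ ∑< n f * c
∑<-*ʳ zero    c f = refl
∑<-*ʳ (suc n) c f = trans (cong (f n * c +_) (∑<-*ʳ n c f)) (sym (*-distribʳ-+ c (f n) _))

∑<-suc : ∀ n (f : ℕ → ℕ) → ∑< (suc n) f ≡ f 0 + ∑< n (λ i → f (suc i))
∑<-suc zero    f = refl
∑<-suc (suc n) f = trans (cong (f (suc n) +_) (∑<-suc n f)) (x∙yz≈y∙xz (f (suc n)) (f 0) _)

∑<-reverse : ∀ n (f : ℕ → ℕ) → ∑< n f ≡ ∑< n (λ i → f (n ∸ suc i))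
∑<-reverse zero    f = refl
∑<-reverse (suc n) f = begin
  f n + ∑< n f                       ≡⟨ cong (f n +_) (∑<-reverse n f) ⟩
  f n + ∑< n (λ i → f (n ∸ suc i))   ≡⟨ ∑<-suc n (λ i → f (n ∸ i)) ⟨
  ∑< (suc n) (λ i → f (n ∸ i))       ∎
  where open ≡-Reasoning

-- Vandermonde's identity for k = m + d after substituting j ↦ m ∸ j; the offset d avoids truncated
-- subtraction and is what varies in the induction on m.
vandermonde : ∀ m p d → ∑< (suc m) (λ j → (m C j) * (p C (j + d))) ≡ (m + p) C (m + d)
vandermonde zero    p d = trans (+-identityʳ _) (+-identityʳ _)
vandermonde (suc m) p d = begin
  ∑< (suc (suc m)) (λ j → (suc m C j) * (p C (j + d)))
    ≡⟨ ∑<-suc (suc m) (λ j → (suc m C j) * (p C (j + d))) ⟩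
  t 0 + ∑< (suc m) (λ j → (suc m C suc j) * (p C (suc j + d)))
    ≡⟨ cong (t 0 +_) (∑<-cong (suc m) (λ j _ → pascal-split j)) ⟩
  t 0 + ∑< (suc m) (λ j → u j + t (suc j))
    ≡⟨ cong (t 0 +_) (∑<-+ (suc m) u (t ∘ suc)) ⟩
  t 0 + (∑< (suc m) u + ∑< (suc m) (t ∘ suc))
    ≡⟨ x∙yz≈y∙xz (t 0) (∑< (suc m) u) (∑< (suc m) (t ∘ suc)) ⟩
  ∑< (suc m) u + (t 0 + ∑< (suc m) (t ∘ suc))
    ≡⟨ cong (∑< (suc m) u +_) (∑<-suc (suc m) t) ⟨
  ∑< (suc m) u + (t (suc m) + ∑< (suc m) t)
    ≡⟨ cong₂ _+_ shifted (trans (cong (_+ ∑< (suc m) t) last-vanishes) (vandermonde m p d)) ⟩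
  (m + p) C (m + suc d) + (m + p) C (m + d)
    ≡⟨ +-comm ((m + p) C (m + suc d)) ((m + p) C (m + d)) ⟩
  (m + p) C (m + d) + (m + p) C (m + suc d)
    ≡⟨ cong (λ k → (m + p) C (m + d) + (m + p) C k) (+-suc m d) ⟩
  (m + p) C (m + d) + (m + p) C suc (m + d)
    ≡⟨ nCk+nC[k+1]≡[n+1]C[k+1] (m + p) (m + d) ⟩
  suc (m + p) C suc (m + d) ∎
  where
  open ≡-Reasoning
  t u : ℕ → ℕ
  t j = (m C j) * (p C (j + d))
  u j = (m C j) * (p C (suc j + d))
  pascal-split : ∀ j → (suc m C suc j) * (p C (suc j + d)) ≡ u j + t (suc j)
  pascal-split j = trans (cong (_* (p C (suc j + d))) (sym (nCk+nC[k+1]≡[n+1]C[k+1] m j)))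
                         (*-distribʳ-+ (p C (suc j + d)) (m C j) (m C suc j))
  last-vanishes : t (suc m) ≡ 0
  last-vanishes = cong (_* (p C (suc m + d))) (k>n⇒nCk≡0 (n<1+n m))
  shifted : ∑< (suc m) u ≡ (m + p) C (m + suc d)
  shifted = trans (∑<-cong (suc m) (λ j _ → cong (λ k → (m C j) * (p C k)) (sym (+-suc j d))))
                  (vandermonde m p (suc d))

∑<-binomial² : ∀ n → ∑< (suc n) (λ j → (n C j) * (n C j)) ≡ (2 * n) C n
∑<-binomial² n = begin
  ∑< (suc n) (λ j → (n C j) * (n C j))       ≡⟨ ∑<-cong (suc n) (λ j _ → cong (λ k → (n C j) * (n C k)) (sym (+-identityʳ j))) ⟩
  ∑< (suc n) (λ j → (n C j) * (n C (j + 0))) ≡⟨ vandermonde n n 0 ⟩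
  (n + n) C (n + 0)                           ≡⟨ cong₂ _C_ (cong (n +_) (sym (+-identityʳ n))) (+-identityʳ n) ⟩
  (2 * n) C n                                 ∎
  where open ≡-Reasoning

∑<-suc*binomial² : ∀ n → 2 * ∑< (suc n) (λ j → suc j * ((n C j) * (n C j))) ≡ (n + 2) * ((2 * n) C n)
∑<-suc*binomial² n = begin
  2 * ∑< (suc n) w                         ≡⟨ cong (∑< (suc n) w +_) (+-identityʳ (∑< (suc n) w)) ⟩
  ∑< (suc n) w + ∑< (suc n) w              ≡⟨ cong (∑< (suc n) w +_) (∑<-reverse (suc n) w) ⟩
  ∑< (suc n) w + ∑< (suc n) (λ j → w (n ∸ j)) ≡⟨ ∑<-+ (suc n) w (λ j → w (n ∸ j)) ⟨
  ∑< (suc n) (λ j → w j + w (n ∸ j))        ≡⟨ ∑<-cong (suc n) (λ j j<1+n → paired j (≤-pred j<1+n)) ⟩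
  ∑< (suc n) (λ j → (n + 2) * sq j)         ≡⟨ ∑<-*ˡ (suc n) (n + 2) sq ⟩
  (n + 2) * ∑< (suc n) sq                   ≡⟨ cong ((n + 2) *_) (∑<-binomial² n) ⟩
  (n + 2) * ((2 * n) C n)                   ∎
  where
  open ≡-Reasoning
  sq w : ℕ → ℕ
  sq j = (n C j) * (n C j)
  w j = suc j * sq j
  paired : ∀ j → j ≤ n → w j + w (n ∸ j) ≡ (n + 2) * sq j
  paired j j≤n = begin
    suc j * sq j + suc (n ∸ j) * sq (n ∸ j) ≡⟨ cong (λ c → suc j * sq j + suc (n ∸ j) * (c * c)) (sym (nCk≡nC[n∸k] j≤n)) ⟩
    suc j * sq j + suc (n ∸ j) * sq j       ≡⟨ *-distribʳ-+ (sq j) (suc j) (suc (n ∸ j)) ⟨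
    (suc j + suc (n ∸ j)) * sq j            ≡⟨ cong (_* sq j) weights ⟩
    (n + 2) * sq j                          ∎
    where
    weights : suc j + suc (n ∸ j) ≡ n + 2
    weights = begin
      suc (j + suc (n ∸ j))   ≡⟨ cong suc (+-suc j (n ∸ j)) ⟩
      suc (suc (j + (n ∸ j))) ≡⟨ cong (λ k → suc (suc k)) (m+[n∸m]≡n j≤n) ⟩
      suc (suc n)             ≡⟨ +-comm 2 n ⟩
      n + 2                   ∎

Below : ℕ → Set
Below a = Σ ℕ (_< a)

Below-≡ : ∀ {a} {x y : Below a} → proj₁ x ≡ proj₁ y → x ≡ y
Below-≡ {x = i , p} {y = .i , q} refl = cong (i ,_) (<-irrelevant p q)

widen : ∀ {a} → Below a → Below (suc a)
widen (i , i<a) = i , m<n⇒m<1+n i<a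

below : (a : ℕ) → List (Below a)
below zero    = []
below (suc a) = (a , n<1+n a) ∷ map widen (below a)

∈-below : ∀ {a} (x : Below a) → x ∈ below a
∈-below {suc a} (i , i<1+a) with i ≟ a
... | yes refl = here (Below-≡ refl)
... | no  i≢a  = there (subst (_∈ map widen (below a)) (Below-≡ refl)
                   (∈-map⁺ widen (∈-below (i , ≤∧≢⇒< (≤-pred i<1+a) i≢a))))

map-proj₁-below : ∀ a → map proj₁ (below a) ≡ downFrom a
map-proj₁-below zero    = refl
map-proj₁-below (suc a) = cong (a ∷_) (trans (sym (map-∘ (below a))) (map-proj₁-below a))

unique-below : ∀ a → Unique (map proj₁ (below a))
unique-below a = subst Unique (sym (map-proj₁-below a)) (Unique.downFrom⁺ a)

sum-below : ∀ a {g : Below a → ℕ} (f : ℕ → ℕ) → (∀ x → g x ≡ f (proj₁ x)) → sum (map g (below a)) ≡ ∑< a f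
sum-below a f g≗f = cong sum (begin
  map _ (below a)             ≡⟨ map-cong g≗f (below a) ⟩
  map (f ∘ proj₁) (below a)   ≡⟨ map-∘ (below a) ⟩
  map f (map proj₁ (below a)) ≡⟨ cong (map f) (map-proj₁-below a) ⟩
  map f (downFrom a)          ∎)
  where open ≡-Reasoning

module _ {A B : Set} where

  length-concatMap : (f : A → List B) (xs : List A) → length (concatMap f xs) ≡ sum (map (λ x → length (f x)) xs)
  length-concatMap f []       = refl
  length-concatMap f (x ∷ xs) = trans (length-++ (f x)) (cong (length (f x) +_) (length-concatMap f xs))

  sum-map-concatMap : (g : B → ℕ) (f : A → List B) (xs : List A) →
                      sum (map g (concatMap f xs)) ≡ sum (map (λ x → sum (map g (f x))) xs)
  sum-map-concatMap g f []       = refl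
  sum-map-concatMap g f (x ∷ xs) = begin
    sum (map g (f x ++ concatMap f xs))              ≡⟨ cong sum (map-++ g (f x) (concatMap f xs)) ⟩
    sum (map g (f x) ++ map g (concatMap f xs))      ≡⟨ sum-++ (map g (f x)) (map g (concatMap f xs)) ⟩
    sum (map g (f x)) + sum (map g (concatMap f xs)) ≡⟨ cong (sum (map g (f x)) +_) (sum-map-concatMap g f xs) ⟩
    sum (map g (f x)) + sum (map (λ x → sum (map g (f x))) xs) ∎
    where open ≡-Reasoning

  ∈-concatMap⁺′ : (f : A → List B) {x : A} {y : B} {xs : List A} → x ∈ xs → y ∈ f x → y ∈ concatMap f xs
  ∈-concatMap⁺′ f x∈xs y∈fx = ∈-concatMap⁺ f (lose x∈xs y∈fx)

  All-concatMap⁺ : ∀ {P : B → Set} (f : A → List B) (xs : List A) → (∀ x → All P (f x)) → All P (concatMap f xs)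
  All-concatMap⁺ f xs all-f = All.concat⁺ (All.map⁺ (All.universal all-f xs))

  unique-concatMap⁺ : ∀ {C : Set} {f : A → List B} (keyᴬ : A → C) (keyᴮ : B → C) {xs : List A} →
                      Unique (map keyᴬ xs) → (∀ x → Unique (f x)) → (∀ x → All (λ y → keyᴮ y ≡ keyᴬ x) (f x)) →
                      Unique (concatMap f xs)
  unique-concatMap⁺ {f = f} keyᴬ keyᴮ {xs} distinct unique-f keyed =
    Unique.concat⁺ (All.map⁺ (All.universal unique-f xs))
                   (AllPairs.map⁺ (AllPairs.map disjoint (AllPairs.map⁻ distinct)))
    where
    disjoint : ∀ {x x′} → keyᴬ x ≢ keyᴬ x′ → Disjoint (f x) (f x′)
    disjoint keys≢ (y∈fx , y∈fx′) = keys≢ (trans (sym (All.lookup (keyed _) y∈fx)) (All.lookup (keyed _) y∈fx′))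

sum-map-const : ∀ {B : Set} (g : B → ℕ) {c : ℕ} {ys : List B} → All (λ y → g y ≡ c) ys → sum (map g ys) ≡ c * length ys
sum-map-const g {c} []            = sym (*-zeroʳ c)
sum-map-const g {c} (gy≡c ∷ g≡c) = trans (cong₂ _+_ gy≡c (sum-map-const g g≡c)) (sym (*-suc c _))

stepVia : ∀ {a b} (x : Below a) (y : Below b) → JumpPath (proj₁ x) (proj₁ y) → JumpPath a b
stepVia x y = step (proj₁ x) (proj₁ y) (proj₂ x) (proj₂ y)

stepVia-injective : ∀ {a b} (x : Below a) (y : Below b) {p q : JumpPath (proj₁ x) (proj₁ y)} →
                    stepVia x y p ≡ stepVia x y q → p ≡ q
stepVia-injective _ _ refl = refl

secondPoint : ∀ {a b} → JumpPath a b → ℕ × ℕ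
secondPoint stop               = 0 , 0
secondPoint (step b₁ b₂ _ _ _) = b₁ , b₂

len≤ : ∀ {a b} (p : JumpPath a b) → len p ≤ a
len≤ stop                = z≤n
len≤ (step _ _ b₁<a _ p) = ≤-trans (s≤s (len≤ p)) b₁<a

pathsOfLength : (k a b : ℕ) → List (JumpPath a b)
pathsVia : ∀ k {a b} (x : Below a) (y : Below b) → List (JumpPath a b)

pathsOfLength zero    zero zero = stop ∷ []
pathsOfLength zero    _    _    = []
pathsOfLength (suc k) a    b    = concatMap (λ x → concatMap (pathsVia k x) (below b)) (below a)

pathsVia k x y = map (stepVia x y) (pathsOfLength k (proj₁ x) (proj₁ y))

allPaths : (a b : ℕ) → List (JumpPath a b)
allPaths a b = concatMap (λ k → pathsOfLength (proj₁ k) a b) (below (suc a))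

∈-pathsOfLength : ∀ {a b} (p : JumpPath a b) → p ∈ pathsOfLength (len p) a b
∈-pathsOfLength stop = here refl
∈-pathsOfLength {a} {b} (step b₁ b₂ b₁<a b₂<b p) =
  ∈-concatMap⁺′ _ (∈-below x) (∈-concatMap⁺′ (pathsVia (len p) x) (∈-below y) (∈-map⁺ (stepVia x y) (∈-pathsOfLength p)))
  where
  x : Below a
  x = b₁ , b₁<a
  y : Below b
  y = b₂ , b₂<b

∈-allPaths : ∀ {a b} (p : JumpPath a b) → p ∈ allPaths a b
∈-allPaths {a} {b} p = ∈-concatMap⁺′ (λ k → pathsOfLength (proj₁ k) a b) (∈-below (len p , s≤s (len≤ p))) (∈-pathsOfLength p)

len-pathsOfLength : ∀ k a b → All (λ p → len p ≡ k) (pathsOfLength k a b)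
len-pathsOfLength zero    zero    zero    = refl ∷ []
len-pathsOfLength zero    zero    (suc b) = []
len-pathsOfLength zero    (suc a) b       = []
len-pathsOfLength (suc k) a       b       =
  All-concatMap⁺ (λ x → concatMap (pathsVia k x) (below b)) (below a) λ x →
    All-concatMap⁺ (pathsVia k x) (below b) λ y → All.map⁺ (All.map (cong suc) (len-pathsOfLength k (proj₁ x) (proj₁ y)))

unique-pathsOfLength : ∀ k a b → Unique (pathsOfLength k a b)
unique-pathsOfLength zero    zero    zero    = [] ∷ []
unique-pathsOfLength zero    zero    (suc b) = []
unique-pathsOfLength zero    (suc a) b       = []
unique-pathsOfLength (suc k) a       b       =
  unique-concatMap⁺ proj₁ (proj₁ ∘ secondPoint) (unique-below a)
    (λ x → unique-concatMap⁺ proj₁ (proj₂ ∘ secondPoint) (unique-below b)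
             (λ y → Unique.map⁺ (stepVia-injective x y) (unique-pathsOfLength k (proj₁ x) (proj₁ y)))
             (λ y → All.map⁺ (All.universal (λ _ → refl) _)))
    (λ x → All-concatMap⁺ (pathsVia k x) (below b) λ y → All.map⁺ (All.universal (λ _ → refl) _))

unique-allPaths : ∀ a b → Unique (allPaths a b)
unique-allPaths a b =
  unique-concatMap⁺ proj₁ len {below (suc a)} (unique-below (suc a))
    (λ k → unique-pathsOfLength (proj₁ k) a b) (λ k → len-pathsOfLength (proj₁ k) a b)

-- The number of strictly decreasing chains a = x₀ > x₁ > ⋯ > x_k = 0.
chains : ℕ → ℕ → ℕ
chains a       (suc k) = ∑< a (λ i → chains i k)
chains zero    zero    = 1
chains (suc _) zero    = 0

chains-suc : ∀ m k → chains (suc m) (suc k) ≡ m C k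
chains-suc zero    zero    = refl
chains-suc zero    (suc k) = sym (k>n⇒nCk≡0 {0} {suc k} z<s)
chains-suc (suc m) zero    = chains-suc m zero
chains-suc (suc m) (suc k) =
  trans (cong₂ _+_ (chains-suc m k) (chains-suc m (suc k))) (nCk+nC[k+1]≡[n+1]C[k+1] m k)

length-pathsOfLength : ∀ k a b → length (pathsOfLength k a b) ≡ chains a k * chains b k
length-pathsOfLength zero    zero    zero    = refl
length-pathsOfLength zero    zero    (suc b) = refl
length-pathsOfLength zero    (suc a) b       = refl
length-pathsOfLength (suc k) a       b       = begin
  length (concatMap (λ x → concatMap (pathsVia k x) (below b)) (below a))
    ≡⟨ length-concatMap (λ x → concatMap (pathsVia k x) (below b)) (below a) ⟩
  sum (map (λ x → length (concatMap (pathsVia k x) (below b))) (below a))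
    ≡⟨ sum-below a (λ i → chains i k * chains b (suc k)) length-via ⟩
  ∑< a (λ i → chains i k * chains b (suc k))
    ≡⟨ ∑<-*ʳ a (chains b (suc k)) (λ i → chains i k) ⟩
  chains a (suc k) * chains b (suc k) ∎
  where
  open ≡-Reasoning
  length-via : ∀ x → length (concatMap (pathsVia k x) (below b)) ≡ chains (proj₁ x) k * chains b (suc k)
  length-via x = begin
    length (concatMap (pathsVia k x) (below b))
      ≡⟨ length-concatMap (pathsVia k x) (below b) ⟩
    sum (map (λ y → length (pathsVia k x y)) (below b))
      ≡⟨ sum-below b (λ j → chains (proj₁ x) k * chains j k)
           (λ y → trans (length-map (stepVia x y) (pathsOfLength k (proj₁ x) (proj₁ y))) (length-pathsOfLength k (proj₁ x) (proj₁ y))) ⟩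
    ∑< b (λ j → chains (proj₁ x) k * chains j k)
      ≡⟨ ∑<-*ˡ b (chains (proj₁ x) k) (λ j → chains j k) ⟩
    chains (proj₁ x) k * chains b (suc k) ∎

totalGaps-allPaths : ∀ a b → totalGaps (allPaths a b) ≡ ∑< (suc a) (λ k → k * (chains a k * chains b k))
totalGaps-allPaths a b = begin
  sum (map len (concatMap (λ k → pathsOfLength (proj₁ k) a b) (below (suc a))))
    ≡⟨ sum-map-concatMap len (λ k → pathsOfLength (proj₁ k) a b) (below (suc a)) ⟩
  sum (map (λ k → sum (map len (pathsOfLength (proj₁ k) a b))) (below (suc a)))
    ≡⟨ sum-below (suc a) (λ k → k * (chains a k * chains b k)) (λ k →
         trans (sum-map-const len (len-pathsOfLength (proj₁ k) a b))
               (cong (proj₁ k *_) (length-pathsOfLength (proj₁ k) a b))) ⟩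
  ∑< (suc a) (λ k → k * (chains a k * chains b k)) ∎
  where open ≡-Reasoning

totalGaps-allPaths-diagonal : ∀ n → 2 * totalGaps (allPaths (suc n) (suc n)) ≡ (n + 2) * ((2 * n) C n)
totalGaps-allPaths-diagonal n = begin
  2 * totalGaps (allPaths (suc n) (suc n))
    ≡⟨ cong (2 *_) (totalGaps-allPaths (suc n) (suc n)) ⟩
  2 * ∑< (suc (suc n)) (λ k → k * (chains (suc n) k * chains (suc n) k))
    ≡⟨ cong (2 *_) (∑<-suc (suc n) (λ k → k * (chains (suc n) k * chains (suc n) k))) ⟩
  2 * ∑< (suc n) (λ j → suc j * (chains (suc n) (suc j) * chains (suc n) (suc j)))
    ≡⟨ cong (2 *_) (∑<-cong (suc n) (λ j _ → cong (λ c → suc j * (c * c)) (chains-suc n j))) ⟩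
  2 * ∑< (suc n) (λ j → suc j * ((n C j) * (n C j)))
    ≡⟨ ∑<-suc*binomial² n ⟩
  (n + 2) * ((2 * n) C n) ∎
  where open ≡-Reasoning

-- The formula also holds for n = 0.
lemma3p3 : (n : ℕ) → 1 ≤ n →
    Σ (List (JumpPath (suc n) (suc n))) λ L →
      ((p : JumpPath (suc n) (suc n)) → p ∈ L) × Unique L
        × (2 * totalGaps L ≡ (n + 2) * ((2 * n) C n))
lemma3p3 n _ = allPaths (suc n) (suc n) , ∈-allPaths , unique-allPaths (suc n) (suc n) , totalGaps-allPaths-diagonal n
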